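{- Let $G$ be a connected finite $\delta$-hyperbolic graph and $P(y,x)$ a shortest path from $y$ to $x$. Then $2\mathcal{U}(P(y,x))+\mathcal{H}(P(y,x))\le\max\{0,4\delta-1\}$ if $P(y,x)$ is strict end-minimal, and $2\mathcal{U}(P(y,x))+\mathcal{H}(P(y,x))\le 4\delta+1$ if $P(y,x)$ is end-minimal. Moreover, for a vertex $x'$ of $P(y,x)$, $2\mathcal{U}(P(y,x'))+\mathcal{H}(P(y,x'))\le 2\delta$ if $e(x')>e(x)+\delta$, or if $P(y,x)$ is end-minimal and $d(x,x')>2\delta$.
   Context: $G$ is $\delta$-hyperbolic if for any four vertices $u,v,w,x$ the two larger of $d(u,v)+d(w,x)$, $d(u,w)+d(v,x)$, $d(u,x)+d(v,w)$ differ by at most $2\delta$ ($d$ = shortest-path distance). $e(v)=\max_u d(v,u)$. Along a path from $y$ to $x$, an ordered edge $(a,b)$ is an up-edge if $e(a)<e(b)$, horizontal if $e(a)=e(b)$; $\mathcal{U}(P)$ and $\mathcal{H}(P)$ count up-edges and horizontal-edges of a path $P$ (traversed from its first to last vertex); $P(y,x')$ is the subpath of $P(y,x)$ from $y$ to $x'$. $P(y,x)$ is end-minimal if $e(x)\le e(v)$ for all $v\in P(y,x)$, strict end-minimal if $e(x)<e(v)$ for all $v\ne x$ on it.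
   Formalization: The hyperbolicity constant δ ranges over the rationals. -}

module Defs where

open import Data.Nat as ℕ using (ℕ; zero; suc; _⊔_; _⊓_; _∸_; _<ᵇ_; _≡ᵇ_)
open import Data.Fin using (Fin)
open import Data.List using (foldr; map; allFin)
open import Data.Bool using (if_then_else_)
open import Data.Integer using (+_)
open import Data.Rational as ℚ using (ℚ; _/_)
open import Data.Product using (_×_; ∃)
open import Relation.Binary.PropositionalEquality using (_≡_; _≢_)
open import Relation.Nullary using (¬_)

record Graph : Set₁ where
  field
    n     : ℕ
    Adj   : Fin n → Fin n → Set
    sym   : ∀ {u v} → Adj u v → Adj v u
    irrefl : ∀ {u} → ¬ Adj u u

module _ (G : Graph) where
  open Graph G

  V : Set
  V = Fin n

  data Walk : V → V → ℕ → Set where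
    here  : ∀ {u} → Walk u u 0
    step  : ∀ {u v w k} → Adj u v → Walk v w k → Walk u w (ℕ.suc k)

  Connected : Set
  Connected = ∀ u v → ∃ (λ k → Walk u v k)

  IsDistance : (V → V → ℕ) → Set
  IsDistance d = ∀ u v → Walk u v (d u v) × (∀ k → Walk u v k → d u v ℕ.≤ k)

  ecc : (V → V → ℕ) → V → ℕ
  ecc d v = foldr _⊔_ 0 (map (d v) (allFin n))

-- maximum and second largest (median) of three naturals
max3 : ℕ → ℕ → ℕ → ℕ
max3 a b c = a ⊔ b ⊔ c

mid3 : ℕ → ℕ → ℕ → ℕ
mid3 a b c = (a ⊓ b) ⊔ ((a ⊔ b) ⊓ c)

⟦_⟧ : ℕ → ℚ
⟦ k ⟧ = + k / 1

Hyperbolic : (G : Graph) → (Fin (Graph.n G) → Fin (Graph.n G) → ℕ) → ℚ → Set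
Hyperbolic G d δ = ∀ u v w x →
  let s₁ = d u v ℕ.+ d w x
      s₂ = d u w ℕ.+ d v x
      s₃ = d u x ℕ.+ d v w
  in ⟦ max3 s₁ s₂ s₃ ∸ mid3 s₁ s₂ s₃ ⟧ ℚ.≤ (+ 2 / 1) ℚ.* δ

record ShortestPath (G : Graph) (d : Fin (Graph.n G) → Fin (Graph.n G) → ℕ)
                    (y x : Fin (Graph.n G)) : Set where
  field
    len   : ℕ
    p     : ℕ → Fin (Graph.n G)
    start : p 0 ≡ y
    end   : p len ≡ x
    adj   : ∀ i → i ℕ.< len → Graph.Adj G (p i) (p (ℕ.suc i))
    short : len ≡ d y x

module _ {G : Graph} {d : Fin (Graph.n G) → Fin (Graph.n G) → ℕ} where
  ups : ∀ {y x} → ShortestPath G d y x → ℕ → ℕ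
  ups P zero = 0
  ups P (ℕ.suc k) = ups P k ℕ.+
    (if ecc G d (p k) <ᵇ ecc G d (p (ℕ.suc k)) then 1 else 0)
    where open ShortestPath P

  hors : ∀ {y x} → ShortestPath G d y x → ℕ → ℕ
  hors P zero = 0
  hors P (ℕ.suc k) = hors P k ℕ.+
    (if ecc G d (p k) ≡ᵇ ecc G d (p (ℕ.suc k)) then 1 else 0)
    where open ShortestPath P

  EndMinimal : ∀ {y x} → ShortestPath G d y x → Set
  EndMinimal {x = x} P = ∀ i → i ℕ.≤ len → ecc G d x ℕ.≤ ecc G d (p i)
    where open ShortestPath P

  StrictEndMinimal : ∀ {y x} → ShortestPath G d y x → Set
  StrictEndMinimal {x = x} P = ∀ i → i ℕ.≤ len → p i ≢ x → ecc G d x ℕ.< ecc G d (p i)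
    where open ShortestPath P

module Submission where

-- Along a shortest path consecutive eccentricities differ by at most one, and an up-, horizontal-
-- or down-edge contributes 2, 1 or 0 to 2U + H; hence 2U + H of P(y, p j) equals j + e(p j) - e(y).
-- In the four-point condition for y, p j, x and a vertex z farthest from p j, the sum
-- d(y,x) + d(p j, z) is the largest one, and its excess over the other two sums is at least
-- 2U + H of P(y, p j), resp. d(p j, x) + e(p j) - e(x). So one of these two numbers is at most 2δ.
-- Taking p j at distance just above 2δ from x bounds the prefix P(y, p j) by 2δ, and the remaining
-- suffix adds at most its length plus e(x) - e(p j).

open import Defs
open import Data.Nat using (ℕ)
open import Data.Product using (_×_; _,_; ∃; proj₁; proj₂)
open import Data.Sum using (_⊎_; inj₁; inj₂; [_,_]; fromInj₂)
open import Relation.Nullary using (¬_; yes; no; contradiction)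
open import Relation.Unary using (Decidable)
open import Relation.Binary.PropositionalEquality
  using (_≡_; _≢_; refl; sym; trans; cong; cong₂; subst; subst₂)

module Arithmetic where
  open import Data.Nat
    using (ℕ; zero; suc; _+_; _*_; _∸_; _⊔_; _⊓_; _≤_; _<_; s≤s; _<ᵇ_; _≡ᵇ_; _≤?_)
  open import Data.Nat.Properties
  open import Data.Bool using (if_then_else_)

  topGap : ℕ → ℕ → ℕ → ℕ
  topGap s₁ s₂ s₃ = max3 s₁ s₂ s₃ ∸ mid3 s₁ s₂ s₃

  topGap-of-middle-max : ∀ {s₁ s₂ s₃} → s₁ ≤ s₂ → s₃ ≤ s₂ →
                         topGap s₁ s₂ s₃ ≡ (s₂ ∸ s₁) ⊓ (s₂ ∸ s₃)
  topGap-of-middle-max {s₁} {s₂} {s₃} s₁≤s₂ s₃≤s₂ = trans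
    (cong₂ _∸_ (trans (cong (_⊔ s₃) (m≤n⇒m⊔n≡n s₁≤s₂)) (m≥n⇒m⊔n≡m s₃≤s₂))
               (cong₂ _⊔_ (m≤n⇒m⊓n≡m s₁≤s₂)
                          (trans (cong (_⊓ s₃) (m≤n⇒m⊔n≡n s₁≤s₂)) (m≥n⇒m⊓n≡n s₃≤s₂))))
    (∸-distribˡ-⊔-⊓ s₂ s₁ s₃)

  ⊓-≤-topGap : ∀ {s₁ s₂ s₃ a b} → a + s₁ ≤ s₂ → b + s₃ ≤ s₂ → a ⊓ b ≤ topGap s₁ s₂ s₃
  ⊓-≤-topGap {a = a} {b} h₁ h₃ =
    subst (a ⊓ b ≤_) (sym (topGap-of-middle-max (m+n≤o⇒n≤o a h₁) (m+n≤o⇒n≤o b h₃)))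
          (⊓-mono-≤ (m+n≤o⇒m≤o∸n a h₁) (m+n≤o⇒m≤o∸n b h₃))

  upIndicator levelIndicator : ℕ → ℕ → ℕ
  upIndicator    a b = if a <ᵇ b then 1 else 0
  levelIndicator a b = if a ≡ᵇ b then 1 else 0

  stepWeight : ℕ → ℕ → ℕ
  stepWeight a b = 2 * upIndicator a b + levelIndicator a b

  +-stepWeight : ∀ a b → a ≤ suc b → b ≤ suc a → a + stepWeight a b ≡ suc b
  +-stepWeight zero          zero          _       _       = refl
  +-stepWeight zero          (suc zero)    _       _       = refl
  +-stepWeight zero          (suc (suc b)) _       (s≤s ())
  +-stepWeight (suc zero)    zero          _       _       = refl
  +-stepWeight (suc (suc a)) zero          (s≤s ()) _
  +-stepWeight (suc a)       (suc b)       (s≤s p) (s≤s q) = cong suc (+-stepWeight a b p q)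

  +-squeeze : ∀ {a b m n} → a ≤ m → b ≤ n → m + n ≤ a + b → a ≡ m × b ≡ n
  +-squeeze {a} {b} {m} {n} a≤m b≤n m+n≤a+b =
      ≤-antisym a≤m (+-cancelʳ-≤ n m a (≤-trans m+n≤a+b (+-monoʳ-≤ a b≤n)))
    , ≤-antisym b≤n (+-cancelˡ-≤ m n b (≤-trans m+n≤a+b (+-monoˡ-≤ b a≤m)))

  module DownSet {Small : ℕ → Set} (Small-↓ : ∀ {m n} → m ≤ n → Small n → Small m) where

    Small-⊓ : ∀ {m n} → Small (m ⊓ n) → Small m ⊎ Small n
    Small-⊓ {m} {n} small with ⊓-sel m n
    ... | inj₁ m⊓n≡m = inj₁ (subst Small m⊓n≡m small)
    ... | inj₂ m⊓n≡n = inj₂ (subst Small m⊓n≡n small)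

    Small⇒≤ : ∀ {m n} → ¬ Small (suc m) → Small n → n ≤ m
    Small⇒≤ {m} {n} ¬small small with n ≤? m
    ... | yes n≤m = n≤m
    ... | no  n≰m = contradiction (Small-↓ (≰⇒> n≰m) small) ¬small

    small-or-boundary : Decidable Small → Small 0 →
                        ∀ L → Small L ⊎ ∃ λ m → m < L × Small m × ¬ Small (suc m)
    small-or-boundary Small? small₀ zero = inj₁ small₀
    small-or-boundary Small? small₀ (suc L) with Small? (suc L) | small-or-boundary Small? small₀ L
    ... | yes small | _                          = inj₁ small
    ... | no ¬small | inj₁ small                 = inj₂ (L , ≤-refl , small , ¬small)
    ... | no _      | inj₂ (m , m<L , boundary) = inj₂ (m , m<n⇒m<1+n m<L , boundary)

module GraphMetric (G : Graph) {d : V G → V G → ℕ} (isDistance : IsDistance G d) where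
  open import Data.Nat
    using (ℕ; zero; suc; pred; _+_; _*_; _∸_; _⊔_; _≤_; _<_; z≤n; s≤s; z<s; s≤s⁻¹; _<?_)
  open import Data.Nat.Properties
  open import Algebra.Properties.CommutativeSemigroup +-commutativeSemigroup
    using (interchange; x∙yz≈y∙xz; x∙yz≈xz∙y; x∙yz≈yx∙z; xy∙z≈xz∙y; xy∙z≈y∙xz)
  open import Data.List using (map; allFin)
  open import Data.List.Properties using (foldr-preservesᵒ)
  import Data.List.Relation.Unary.Any as Any
  open import Data.List.Membership.Propositional.Properties
    using (foldr-selective; ∈-map⁺; ∈-map⁻; ∈-allFin)
  open import Relation.Binary.PropositionalEquality using (module ≡-Reasoning)
  open Graph G using (Adj) renaming (sym to Adj-sym)
  open Arithmetic

  e : V G → ℕ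
  e = ecc G d

  walk-++ : ∀ {u v w k l} → Walk G u v k → Walk G v w l → Walk G u w (k + l)
  walk-++ here       q = q
  walk-++ (step a p) q = step a (walk-++ p q)

  walk-reverse : ∀ {u v k} → Walk G u v k → Walk G v u k
  walk-reverse here                = here
  walk-reverse (step {k = k} a p) =
    subst (Walk G _ _) (+-comm k 1) (walk-++ (walk-reverse p) (step (Adj-sym a) here))

  d-minimal : ∀ {u v k} → Walk G u v k → d u v ≤ k
  d-minimal {u} {v} p = proj₂ (isDistance u v) _ p

  d-triangle : ∀ u v w → d u w ≤ d u v + d v w
  d-triangle u v w = d-minimal (walk-++ (proj₁ (isDistance u v)) (proj₁ (isDistance v w)))

  d-sym : ∀ u v → d u v ≡ d v u
  d-sym u v = ≤-antisym (d-minimal (walk-reverse (proj₁ (isDistance v u))))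
                        (d-minimal (walk-reverse (proj₁ (isDistance u v))))

  d-self : ∀ v → d v v ≡ 0
  d-self v = n≤0⇒n≡0 (d-minimal here)

  0<d⇒≢ : ∀ {u v} → 0 < d u v → u ≢ v
  0<d⇒≢ {u} 0<d refl = <-irrefl (sym (d-self u)) 0<d

  d≤ecc : ∀ v u → d v u ≤ e v
  d≤ecc v u = foldr-preservesᵒ ⊔-upper 0 (map (d v) (allFin _))
                (inj₂ (Any.map ≤-reflexive (∈-map⁺ (d v) (∈-allFin u))))
    where
    ⊔-upper : ∀ a b → d v u ≤ a ⊎ d v u ≤ b → d v u ≤ a ⊔ b
    ⊔-upper a b = [ m≤n⇒m≤n⊔o b , m≤n⇒m≤o⊔n a ]

  ecc-attained : ∀ v → ∃ λ z → d v z ≡ e v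
  ecc-attained v with foldr-selective ⊔-sel 0 (map (d v) (allFin _))
  ... | inj₁ e≡0 = v , trans (d-self v) (sym e≡0)
  ... | inj₂ e∈  with ∈-map⁻ (d v) e∈
  ...   | z , _ , e≡d = z , sym e≡d

  ecc-lipschitz : ∀ u v → e u ≤ d u v + e v
  ecc-lipschitz u v with ecc-attained u
  ... | z , dz = begin
    e u            ≡⟨ dz ⟨
    d u z          ≤⟨ d-triangle u v z ⟩
    d u v + d v z  ≤⟨ +-monoʳ-≤ (d u v) (d≤ecc v z) ⟩
    d u v + e v    ∎
    where open ≤-Reasoning

  ecc-adjacent : ∀ {u v} → Adj u v → e u ≤ suc (e v)
  ecc-adjacent {u} {v} uv = ≤-trans (ecc-lipschitz u v) (+-monoˡ-≤ (e v) (d-minimal (step uv here)))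

  module FourPoint {Small : ℕ → Set} (Small-↓ : ∀ {m n} → m ≤ n → Small n → Small m)
      (gap-Small : ∀ u v w z → Small (topGap (d u v + d w z) (d u w + d v z) (d u z + d v w))) where
    open DownSet Small-↓

    -- Four-point condition for y, x′, x and a vertex z farthest from x′.
    geodesic-dichotomy : ∀ {y x′ x k c} → d y x ≡ d y x′ + d x′ x →
      k + e x ≤ d x′ x + e x′ → c + e y ≤ d y x′ + e x′ → Small k ⊎ Small c
    geodesic-dichotomy {y} {x′} {x} {k} {c} between hk hc with ecc-attained x′
    ... | z , dz = Small-⊓ (Small-↓ (⊓-≤-topGap k-room c-room) (gap-Small y x′ x z))
      where
      open ≤-Reasoning
      k-room : k + (d y x′ + d x z) ≤ d y x + d x′ z
      k-room = begin
        k + (d y x′ + d x z)      ≤⟨ +-monoʳ-≤ k (+-monoʳ-≤ (d y x′) (d≤ecc x z)) ⟩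
        k + (d y x′ + e x)        ≡⟨ x∙yz≈y∙xz k (d y x′) (e x) ⟩
        d y x′ + (k + e x)        ≤⟨ +-monoʳ-≤ (d y x′) hk ⟩
        d y x′ + (d x′ x + e x′)  ≡⟨ +-assoc (d y x′) (d x′ x) (e x′) ⟨
        d y x′ + d x′ x + e x′    ≡⟨ cong₂ _+_ between dz ⟨
        d y x + d x′ z            ∎
      c-room : c + (d y z + d x′ x) ≤ d y x + d x′ z
      c-room = begin
        c + (d y z + d x′ x)      ≤⟨ +-monoʳ-≤ c (+-monoˡ-≤ (d x′ x) (d≤ecc y z)) ⟩
        c + (e y + d x′ x)        ≡⟨ +-assoc c (e y) (d x′ x) ⟨
        c + e y + d x′ x          ≤⟨ +-monoˡ-≤ (d x′ x) hc ⟩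
        d y x′ + e x′ + d x′ x    ≡⟨ xy∙z≈xz∙y (d y x′) (e x′) (d x′ x) ⟩
        d y x′ + d x′ x + e x′    ≡⟨ cong₂ _+_ between dz ⟨
        d y x + d x′ z            ∎

  module OnShortestPath {y x} (P : ShortestPath G d y x) where
    open ShortestPath P renaming (start to p₀≡y; end to p-len≡x)

    cost : ℕ → ℕ
    cost j = 2 * ups P j + hors P j

    segment : ∀ k i → k + i ≤ len → Walk G (p i) (p (k + i)) k
    segment zero    i _         = here
    segment (suc k) i k+i<len = step (adj i (≤-trans (m≤n+m (suc i) k) bound))
      (subst (λ j → Walk G (p (suc i)) (p j) k) (+-suc k i) (segment k (suc i) bound))
      where
      bound : k + suc i ≤ len
      bound = subst (_≤ len) (sym (+-suc k i)) k+i<len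

    distances : ∀ {j} → j ≤ len → d y (p j) ≡ j × d (p j) x ≡ len ∸ j
    distances {j} j≤len = +-squeeze (d-minimal prefix) (d-minimal suffix) (begin
      j + (len ∸ j)          ≡⟨ m+[n∸m]≡n j≤len ⟩
      len                    ≡⟨ short ⟩
      d y x                  ≤⟨ d-triangle y (p j) x ⟩
      d y (p j) + d (p j) x  ∎)
      where
      open ≤-Reasoning
      prefix : Walk G y (p j) j
      prefix = subst₂ (λ u v → Walk G u v j) p₀≡y (cong p (+-identityʳ j))
                      (segment j 0 (subst (_≤ len) (sym (+-identityʳ j)) j≤len))
      suffix : Walk G (p j) x (len ∸ j)
      suffix = subst (λ v → Walk G (p j) v (len ∸ j)) (trans (cong p (m∸n+n≡m j≤len)) p-len≡x)
                     (segment (len ∸ j) j (≤-reflexive (m∸n+n≡m j≤len)))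

    d-to-end : ∀ {j} → j ≤ len → d (p j) x ≡ len ∸ j
    d-to-end j≤len = proj₂ (distances j≤len)

    j+d-to-end : ∀ {j} → j ≤ len → j + d (p j) x ≡ len
    j+d-to-end {j} j≤len = trans (cong (j +_) (d-to-end j≤len)) (m+[n∸m]≡n j≤len)

    d-at-distance : ∀ {D} → D ≤ len → d (p (len ∸ D)) x ≡ D
    d-at-distance {D} D≤len = trans (d-to-end (m∸n≤m len D)) (m∸[m∸n]≡n D≤len)

    cost-suc : ∀ k → cost (suc k) ≡ cost k + stepWeight (e (p k)) (e (p (suc k)))
    cost-suc k = trans
      (cong (_+ (hors P k + levelIndicator a b)) (*-distribˡ-+ 2 (ups P k) (upIndicator a b)))
      (interchange (2 * ups P k) (2 * upIndicator a b) (hors P k) (levelIndicator a b))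
      where
      a b : ℕ
      a = e (p k)
      b = e (p (suc k))

    cost-identity : ∀ {j} → j ≤ len → cost j + e y ≡ j + e (p j)
    cost-identity {zero}  _       = cong e (sym p₀≡y)
    cost-identity {suc k} k<len = begin
      cost (suc k) + e y        ≡⟨ cong (_+ e y) (cost-suc k) ⟩
      cost k + w + e y          ≡⟨ xy∙z≈xz∙y (cost k) w (e y) ⟩
      cost k + e y + w          ≡⟨ cong (_+ w) (cost-identity (<⇒≤ k<len)) ⟩
      k + e (p k) + w           ≡⟨ +-assoc k (e (p k)) w ⟩
      k + (e (p k) + w)         ≡⟨ cong (k +_) (+-stepWeight _ _ (ecc-adjacent edge)
                                                                (ecc-adjacent (Adj-sym edge))) ⟩
      k + suc (e (p (suc k)))   ≡⟨ +-suc k _ ⟩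
      suc k + e (p (suc k))     ∎
      where
      open ≡-Reasoning
      w : ℕ
      w = stepWeight (e (p k)) (e (p (suc k)))
      edge : Adj (p k) (p (suc k))
      edge = adj k k<len

    cost-increment : ∀ {j s} → j ≤ len → s + e x ≤ e (p j) → s + cost len ≤ cost j + d (p j) x
    cost-increment {j} {s} j≤len hs = +-cancelʳ-≤ (e y) _ _ (begin
      s + cost len + e y        ≡⟨ +-assoc s (cost len) (e y) ⟩
      s + (cost len + e y)      ≡⟨ cong (s +_) identity-at-end ⟩
      s + (len + e x)           ≡⟨ x∙yz≈xz∙y s len (e x) ⟩
      s + e x + len             ≤⟨ +-monoˡ-≤ len hs ⟩
      e (p j) + len             ≡⟨ cong (e (p j) +_) (j+d-to-end j≤len) ⟨
      e (p j) + (j + D)         ≡⟨ x∙yz≈yx∙z (e (p j)) j D ⟩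
      j + e (p j) + D           ≡⟨ cong (_+ D) (cost-identity j≤len) ⟨
      cost j + e y + D          ≡⟨ xy∙z≈xz∙y (cost j) (e y) D ⟩
      cost j + D + e y          ∎)
      where
      open ≤-Reasoning
      D : ℕ
      D = d (p j) x
      identity-at-end : cost len + e y ≡ len + e x
      identity-at-end = trans (cost-identity ≤-refl) (cong (λ v → len + e v) p-len≡x)

    strictly-below : StrictEndMinimal P → ∀ {j} → j ≤ len → 0 < d (p j) x → e x < e (p j)
    strictly-below sem j≤len 0<d = sem _ j≤len (0<d⇒≢ 0<d)

    strictly-below-at-distance : StrictEndMinimal P → ∀ {D} → D ≤ len → 0 < D → e x < e (p (len ∸ D))
    strictly-below-at-distance sem {D} D≤len 0<D =
      strictly-below sem (m∸n≤m len D) (subst (0 <_) (sym (d-at-distance D≤len)) 0<D)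

    module CostBounds (Small : ℕ → Set) (Small-↓ : ∀ {m n} → m ≤ n → Small n → Small m)
        (gap-Small : ∀ u v w z → Small (topGap (d u v + d w z) (d u w + d v z) (d u z + d v w)))
        (Small? : Decidable Small) where
      open DownSet Small-↓
      open FourPoint Small-↓ gap-Small

      cost-small : ∀ {j k} → j ≤ len → ¬ Small k → k + e x ≤ d (p j) x + e (p j) → Small (cost j)
      cost-small {j} j≤len ¬small hk =
        fromInj₂ (λ small → contradiction small ¬small) (geodesic-dichotomy between hk hc)
        where
        dy : d y (p j) ≡ j
        dy = proj₁ (distances j≤len)
        between : d y x ≡ d y (p j) + d (p j) x
        between = trans (sym short) (trans (sym (j+d-to-end j≤len)) (cong (_+ d (p j) x) (sym dy)))
        hc : cost j + e y ≤ d y (p j) + e (p j)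
        hc = ≤-reflexive (trans (cost-identity j≤len) (cong (_+ e (p j)) (sym dy)))

      cost-small-if-ecc-far : ∀ {j} → j ≤ len →
        (∀ {k} → e (p j) + e (p j) ≤ e x + e x + k → ¬ Small k) → Small (cost j)
      cost-small-if-ecc-far {j} j≤len not-small = cost-small j≤len (not-small doubled) (≤-reflexive k+ex)
        where
        open ≤-Reasoning
        D k : ℕ
        D = d (p j) x
        k = D + e (p j) ∸ e x
        k+ex : k + e x ≡ D + e (p j)
        k+ex = m∸n+n≡m (subst (λ t → e x ≤ t + e (p j)) (d-sym x (p j)) (ecc-lipschitz x (p j)))
        doubled : e (p j) + e (p j) ≤ e x + e x + k
        doubled = begin
          e (p j) + e (p j)     ≤⟨ +-monoˡ-≤ (e (p j)) (ecc-lipschitz (p j) x) ⟩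
          D + e x + e (p j)     ≡⟨ xy∙z≈y∙xz D (e x) (e (p j)) ⟩
          e x + (D + e (p j))   ≡⟨ cong (e x +_) k+ex ⟨
          e x + (k + e x)       ≡⟨ x∙yz≈xz∙y (e x) k (e x) ⟩
          e x + e x + k         ∎

      cost-small-if-end-far : EndMinimal P → ∀ {j} → j ≤ len → ¬ Small (d x (p j)) → Small (cost j)
      cost-small-if-end-far em {j} j≤len ¬small =
        cost-small j≤len (subst (λ t → ¬ Small t) (d-sym x (p j)) ¬small)
                         (+-monoʳ-≤ (d (p j) x) (em j j≤len))

      Small-0 : Small 0
      Small-0 = Small-↓ z≤n (gap-Small y y y y)

      -- p (len ∸ D) is the vertex of P at distance D from x.
      cost-bound : ∀ {m s D} → D ≤ len → ¬ Small (suc m) → suc m ≤ D + s →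
                   s + e x ≤ e (p (len ∸ D)) → s + cost len ≤ m + D
      cost-bound {m} {s} {D} D≤len ¬small m<D+s hs = begin
        s + cost len         ≤⟨ cost-increment j≤len hs ⟩
        cost j + d (p j) x   ≤⟨ +-mono-≤ (Small⇒≤ ¬small (cost-small j≤len ¬small hk)) (≤-reflexive dj) ⟩
        m + D                ∎
        where
        open ≤-Reasoning
        j : ℕ
        j = len ∸ D
        j≤len : j ≤ len
        j≤len = m∸n≤m len D
        dj : d (p j) x ≡ D
        dj = d-at-distance D≤len
        hk : suc m + e x ≤ d (p j) x + e (p j)
        hk = begin
          suc m + e x          ≤⟨ +-monoˡ-≤ (e x) m<D+s ⟩
          D + s + e x          ≡⟨ +-assoc D s (e x) ⟩
          D + (s + e x)        ≤⟨ +-mono-≤ (≤-reflexive (sym dj)) hs ⟩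
          d (p j) x + e (p j)  ∎

      endMinimal-cost : EndMinimal P → ∃ λ m → Small m × cost len ≤ m + m + 1
      endMinimal-cost em with small-or-boundary Small? Small-0 len
      ... | inj₁ small-len = len , small-len , (begin
        cost len       ≤⟨ cost-increment z≤n (em 0 z≤n) ⟩
        d (p 0) x      ≡⟨ d-to-end z≤n ⟩
        len            ≤⟨ m≤m+n len len ⟩
        len + len      ≤⟨ m≤m+n (len + len) 1 ⟩
        len + len + 1  ∎)
        where open ≤-Reasoning
      ... | inj₂ (m , m<len , small-m , ¬small) = m , small-m , (begin
        cost len       ≤⟨ cost-bound m<len ¬small (m≤m+n (suc m) 0) (em _ (m∸n≤m len (suc m))) ⟩
        m + suc m      ≡⟨ +-suc m m ⟩
        suc (m + m)    ≡⟨ +-comm 1 (m + m) ⟩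
        m + m + 1      ∎)
        where open ≤-Reasoning

      strictEndMinimal-cost : StrictEndMinimal P → ∃ λ m → Small m × cost len ≤ pred (m + m)
      strictEndMinimal-cost sem with small-or-boundary Small? Small-0 len
      ... | inj₁ small-len = len , small-len , ≤-trans whole (pred-mono-≤ (m≤m+n len len))
        where
        whole : cost len ≤ pred len
        whole with 0 <? len
        ... | yes 0<len = pred-mono-≤ (≤-trans (cost-increment {s = 1} z≤n ex<ep₀) (≤-reflexive (d-to-end z≤n)))
          where
          ex<ep₀ : e x < e (p 0)
          ex<ep₀ = strictly-below sem z≤n (subst (0 <_) (sym (d-to-end z≤n)) 0<len)
        ... | no  0≮len = subst (λ l → cost l ≤ pred l) (sym (n≤0⇒n≡0 (≮⇒≥ 0≮len))) z≤n
      -- The vertex at distance 0 is x itself, where strictness fails: use the one at distance 1.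
      ... | inj₂ (zero , 0<len , small-0 , ¬small) =
        0 , small-0 ,
        s≤s⁻¹ (cost-bound {s = 1} 0<len ¬small (s≤s z≤n) (strictly-below-at-distance sem 0<len z<s))
      ... | inj₂ (suc m , m<len , small-m , ¬small) =
        suc m , small-m ,
        s≤s⁻¹ (cost-bound {s = 1} (<⇒≤ m<len) ¬small (≤-reflexive (+-comm 1 (suc m)))
                          (strictly-below-at-distance sem (<⇒≤ m<len) z<s))

open import Data.Nat using (ℕ; _≤_)
open import Data.Integer using (+_)
open import Data.Rational using (ℚ; _/_; _+_; _-_; _*_; _⊔_; _<_) renaming (_≤_ to _≤ℚ_)
open import Data.Product using (_×_)
open import Data.Sum using (_⊎_)
open import Data.Fin using (Fin)
import Data.Nat as ℕ
import Data.Integer as ℤ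
import Data.Integer.Properties as ℤₚ
open import Data.Integer.Tactic.RingSolver using (solve-∀)
open import Data.Rational using (toℚᵘ; 1ℚ; -_)
open import Data.Rational.Properties as ℚₚ
  using (toℚᵘ-injective; toℚᵘ-fromℚᵘ; toℚᵘ-homo-+; +-mono-≤; +-mono-<; +-monoˡ-≤; p≤p⊔q; p≤q⊔p)
open import Data.Rational.Unnormalised as ℚᵘ using (ℚᵘ; mkℚᵘ; *≡*; *≤*)
import Data.Rational.Unnormalised.Properties as ℚᵘₚ
open import Algebra.Bundles using (CommutativeMonoid)
open import Algebra.Properties.CommutativeSemigroup
  (CommutativeMonoid.commutativeSemigroup ℚₚ.+-0-commutativeMonoid) using (interchange)
open import Algebra.Properties.AbelianGroup ℚₚ.+-0-abelianGroup using (xyx⁻¹≈y)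

⌜_⌝ : ℕ → ℚᵘ
⌜ k ⌝ = mkℚᵘ (+ k) 0

⌜⌝-+ : ∀ m n → ⌜ m ℕ.+ n ⌝ ℚᵘ.≃ ⌜ m ⌝ ℚᵘ.+ ⌜ n ⌝
⌜⌝-+ m n = *≡* (lemma (+ m) (+ n))
  where
  lemma : ∀ a b → (a ℤ.+ b) ℤ.* + 1 ≡ (a ℤ.* + 1 ℤ.+ b ℤ.* + 1) ℤ.* + 1
  lemma = solve-∀

⟦⟧-+ : ∀ m n → ⟦ m ℕ.+ n ⟧ ≡ ⟦ m ⟧ + ⟦ n ⟧
⟦⟧-+ m n = toℚᵘ-injective (begin
  toℚᵘ ⟦ m ℕ.+ n ⟧            ≈⟨ toℚᵘ-fromℚᵘ ⌜ m ℕ.+ n ⌝ ⟩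
  ⌜ m ℕ.+ n ⌝                 ≈⟨ ⌜⌝-+ m n ⟩
  ⌜ m ⌝ ℚᵘ.+ ⌜ n ⌝            ≈⟨ ℚᵘₚ.+-cong (toℚᵘ-fromℚᵘ ⌜ m ⌝) (toℚᵘ-fromℚᵘ ⌜ n ⌝) ⟨
  toℚᵘ ⟦ m ⟧ ℚᵘ.+ toℚᵘ ⟦ n ⟧  ≈⟨ toℚᵘ-homo-+ ⟦ m ⟧ ⟦ n ⟧ ⟨
  toℚᵘ (⟦ m ⟧ + ⟦ n ⟧)        ∎)
  where open ℚᵘₚ.≃-Reasoning

⟦⟧-mono-≤ : ∀ {m n} → m ≤ n → ⟦ m ⟧ ≤ℚ ⟦ n ⟧
⟦⟧-mono-≤ {m} {n} m≤n = ℚₚ.toℚᵘ-cancel-≤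
  (ℚᵘₚ.≤-respˡ-≃ (ℚᵘₚ.≃-sym (toℚᵘ-fromℚᵘ ⌜ m ⌝)) (ℚᵘₚ.≤-respʳ-≃ (ℚᵘₚ.≃-sym (toℚᵘ-fromℚᵘ ⌜ n ⌝))
    (*≤* (ℤₚ.*-monoʳ-≤-nonNeg (+ 1) (ℤ.+≤+ m≤n)))))

module _ (δ : ℚ) where

  Within2δ : ℕ → Set
  Within2δ k = ⟦ k ⟧ ≤ℚ (+ 2 / 1) * δ

  Within2δ-↓ : ∀ {m n} → m ≤ n → Within2δ n → Within2δ m
  Within2δ-↓ m≤n = ℚₚ.≤-trans (⟦⟧-mono-≤ m≤n)

  Within2δ? : Decidable Within2δ
  Within2δ? k = ⟦ k ⟧ ℚₚ.≤? (+ 2 / 1) * δ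

  4δ≡2δ+2δ : (+ 4 / 1) * δ ≡ (+ 2 / 1) * δ + (+ 2 / 1) * δ
  4δ≡2δ+2δ = ℚₚ.*-distribʳ-+ δ (+ 2 / 1) (+ 2 / 1)

  ⟦m+m⟧≤4δ : ∀ m → Within2δ m → ⟦ m ℕ.+ m ⟧ ≤ℚ (+ 4 / 1) * δ
  ⟦m+m⟧≤4δ m small = subst₂ _≤ℚ_ (sym (⟦⟧-+ m m)) (sym 4δ≡2δ+2δ) (+-mono-≤ small small)

  end-bound : ∀ {c} → (∃ λ m → Within2δ m × c ≤ m ℕ.+ m ℕ.+ 1) → ⟦ c ⟧ ≤ℚ (+ 4 / 1) * δ + (+ 1 / 1)
  end-bound {c} (m , small , c≤) = ℚₚ.≤-trans (⟦⟧-mono-≤ c≤)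
    (subst (_≤ℚ (+ 4 / 1) * δ + (+ 1 / 1)) (sym (⟦⟧-+ (m ℕ.+ m) 1))
           (+-monoˡ-≤ (+ 1 / 1) (⟦m+m⟧≤4δ m small)))

  strict-bound : ∀ {c} → (∃ λ m → Within2δ m × c ≤ ℕ.pred (m ℕ.+ m)) →
                 ⟦ c ⟧ ≤ℚ (+ 0 / 1) ⊔ ((+ 4 / 1) * δ - (+ 1 / 1))
  strict-bound {c} (ℕ.zero , _ , c≤0) = ℚₚ.≤-trans (⟦⟧-mono-≤ c≤0) (p≤p⊔q (+ 0 / 1) ((+ 4 / 1) * δ - 1ℚ))
  strict-bound {c} (ℕ.suc m , small , c≤) = ℚₚ.≤-trans below-4δ-1 (p≤q⊔p (+ 0 / 1) ((+ 4 / 1) * δ - 1ℚ))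
    where
    1+c≤4δ : 1ℚ + ⟦ c ⟧ ≤ℚ (+ 4 / 1) * δ
    1+c≤4δ = subst (_≤ℚ _) (⟦⟧-+ 1 c) (ℚₚ.≤-trans (⟦⟧-mono-≤ (ℕ.s≤s c≤)) (⟦m+m⟧≤4δ (ℕ.suc m) small))
    below-4δ-1 : ⟦ c ⟧ ≤ℚ (+ 4 / 1) * δ - 1ℚ
    below-4δ-1 = subst (_≤ℚ _) (xyx⁻¹≈y 1ℚ ⟦ c ⟧) (+-monoˡ-≤ (- 1ℚ) 1+c≤4δ)

  far-from-2δ : ∀ k → (+ 2 / 1) * δ < ⟦ k ⟧ → ¬ Within2δ k
  far-from-2δ _ 2δ<k k≤2δ = ℚₚ.<-irrefl refl (ℚₚ.<-≤-trans 2δ<k k≤2δ)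

  ecc-far-from-2δ : ∀ e e′ {k} → ⟦ e ⟧ + δ < ⟦ e′ ⟧ → e′ ℕ.+ e′ ≤ e ℕ.+ e ℕ.+ k → ¬ Within2δ k
  ecc-far-from-2δ e e′ {k} e+δ<e′ le k≤2δ = ℚₚ.<-irrefl refl (begin-strict
    (⟦ e ⟧ + ⟦ e ⟧) + (δ + δ)              ≡⟨ interchange ⟦ e ⟧ δ ⟦ e ⟧ δ ⟨
    (⟦ e ⟧ + δ) + (⟦ e ⟧ + δ)              <⟨ +-mono-< e+δ<e′ e+δ<e′ ⟩
    ⟦ e′ ⟧ + ⟦ e′ ⟧                        ≡⟨ ⟦⟧-+ e′ e′ ⟨
    ⟦ e′ ℕ.+ e′ ⟧                          ≤⟨ ⟦⟧-mono-≤ le ⟩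
    ⟦ e ℕ.+ e ℕ.+ k ⟧                      ≡⟨ trans (⟦⟧-+ (e ℕ.+ e) k) (cong (_+ ⟦ k ⟧) (⟦⟧-+ e e)) ⟩
    (⟦ e ⟧ + ⟦ e ⟧) + ⟦ k ⟧                ≤⟨ ℚₚ.+-monoʳ-≤ (⟦ e ⟧ + ⟦ e ⟧) k≤2δ ⟩
    (⟦ e ⟧ + ⟦ e ⟧) + (+ 2 / 1) * δ        ≡⟨ cong (_+_ (⟦ e ⟧ + ⟦ e ⟧)) 2δ≡δ+δ ⟩
    (⟦ e ⟧ + ⟦ e ⟧) + (δ + δ)              ∎)
    where
    open ℚₚ.≤-Reasoning
    2δ≡δ+δ : (+ 2 / 1) * δ ≡ δ + δ
    2δ≡δ+δ = trans (ℚₚ.*-distribʳ-+ δ 1ℚ 1ℚ) (cong₂ _+_ (ℚₚ.*-identityˡ δ) (ℚₚ.*-identityˡ δ))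

theorem20 : (G : Graph) (d : Fin (Graph.n G) → Fin (Graph.n G) → ℕ) (δ : ℚ) →
    Connected G → IsDistance G d → Hyperbolic G d δ →
    (y x : Fin (Graph.n G)) (P : ShortestPath G d y x) →
    (StrictEndMinimal P →
      ⟦ 2 Data.Nat.* ups P (ShortestPath.len P) Data.Nat.+ hors P (ShortestPath.len P) ⟧
        ≤ℚ (+ 0 / 1) ⊔ ((+ 4 / 1) * δ - (+ 1 / 1)))
    × (EndMinimal P →
      ⟦ 2 Data.Nat.* ups P (ShortestPath.len P) Data.Nat.+ hors P (ShortestPath.len P) ⟧
        ≤ℚ (+ 4 / 1) * δ + (+ 1 / 1))
    × (∀ j → j ≤ ShortestPath.len P →
        ((⟦ ecc G d x ⟧ + δ < ⟦ ecc G d (ShortestPath.p P j) ⟧)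
          ⊎ (EndMinimal P × (+ 2 / 1) * δ < ⟦ d x (ShortestPath.p P j) ⟧)) →
        ⟦ 2 Data.Nat.* ups P j Data.Nat.+ hors P j ⟧ ≤ℚ (+ 2 / 1) * δ)
theorem20 G d δ _ isDistance hyperbolic y x P =
    (λ sem → strict-bound δ (strictEndMinimal-cost sem))
  , (λ em → end-bound δ (endMinimal-cost em))
  , λ j j≤len →
      [ (λ ecc-far → cost-small-if-ecc-far j≤len (ecc-far-from-2δ δ (e x) (e (p j)) ecc-far))
      , (λ (em , end-far) → cost-small-if-end-far em j≤len (far-from-2δ δ (d x (p j)) end-far)) ]
  where
  open ShortestPath P using (p)
  open GraphMetric G isDistance
  open OnShortestPath P
  open CostBounds (Within2δ δ) (Within2δ-↓ δ) hyperbolic (Within2δ? δ)
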